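{- If $\varphi(\mathbf{x},\mathbf{y})$ is a P-encoding with $n\ge7$ input variables $\mathbf{x}=(x_1,\dots,x_n)$ which is in regular form, then $|\varphi|\ge 2n+\sqrt{n-3/4}-3/2$.
   Context: A CNF formula is a conjunction (set) of clauses (disjunctions of literals with no complementary pair); its size $|\varphi|$ is its number of clauses. Unit resolution: from a unit clause $l$ and a clause containing $\neg l$ derive the clause with $\neg l$ removed; $\varphi\wedge g\vdash_1 h$ means the literal $h$ is derivable from $\varphi$ and the unit clause $g$ by a sequence of unit resolutions. $\varphi(\mathbf{x},\mathbf{y})$ with input variables $x_1,\dots,x_n$ and auxiliary variables $\mathbf{y}$ is a P-encoding if (P1) $\varphi\wedge x_i$ is satisfiable for each $i$ and (P2) $\varphi\wedge x_i\vdash_1\neg x_j$ for all $i\ne j$. Let $Q_{\varphi,i}=\{C\in\varphi:\neg x_i\in C\}$. A P-encoding is in regular form if for each $i$: (R1) $|Q_{\varphi,i}|=2$; (R2) the clauses of $Q_{\varphi,i}$ contain no input variable other than $x_i$; (R3) the clauses of $Q_{\varphi,i}$ are binary. -}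

module Defs where

open import Data.Nat using (ℕ; _≤_; _+_; _*_; _∸_; _^_)
open import Data.Fin using (Fin)
import Data.Fin.Properties as FinP
open import Data.Bool using (Bool; true; false; not)
import Data.Bool.Properties as BoolP
open import Data.Sum using (_⊎_; inj₁; inj₂)
import Data.Sum.Properties as SumP
open import Data.Product using (_×_; _,_; proj₁; proj₂; Σ; ∃)
import Data.Product.Properties as ProdP
open import Data.List using (List; []; _∷_; length; filter)
open import Data.List.Relation.Unary.All using (All)
open import Data.List.Relation.Unary.Any using (Any)
open import Data.List.Relation.Unary.AllPairs using (AllPairs)
open import Data.List.Relation.Unary.Unique.Propositional using (Unique)
open import Data.List.Membership.Propositional using (_∈_; _∉_)
open import Relation.Binary.PropositionalEquality using (_≡_; _≢_)
open import Relation.Binary.Definitions using (DecidableEquality)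
open import Relation.Nullary using (¬_)
import Data.List.Membership.DecPropositional as DecMem

-- Variables: n input variables (inj₁) and k auxiliary variables (inj₂).
Var : ℕ → ℕ → Set
Var n k = Fin n ⊎ Fin k

-- A literal is a variable with a polarity (true = positive, false = negated).
Lit : ℕ → ℕ → Set
Lit n k = Var n k × Bool

_≟L_ : ∀ {n k} → DecidableEquality (Lit n k)
_≟L_ = ProdP.≡-dec (SumP.≡-dec FinP._≟_ FinP._≟_) BoolP._≟_

neg : ∀ {n k} → Lit n k → Lit n k
neg (v , b) = (v , not b)

inp : ∀ {n k} → Fin n → Lit n k
inp i = (inj₁ i , true)

Clause : ℕ → ℕ → Set
Clause n k = List (Lit n k)

WfClause : ∀ {n k} → Clause n k → Set
WfClause C = Unique C × (∀ l → l ∈ C → neg l ∉ C)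

SameSet : ∀ {n k} → Clause n k → Clause n k → Set
SameSet C D = ∀ l → (l ∈ C → l ∈ D) × (l ∈ D → l ∈ C)

CNF : ℕ → ℕ → Set
CNF n k = List (Clause n k)

WfCNF : ∀ {n k} → CNF n k → Set
WfCNF φ = All WfClause φ × AllPairs (λ C D → ¬ SameSet C D) φ

size : ∀ {n k} → CNF n k → ℕ
size = length

-- Clauses derivable by unit resolution from φ ∧ g.
data Derivable {n k} (φ : CNF n k) (g : Lit n k) : Clause n k → Set where
  axiom   : ∀ {C} → C ∈ φ → Derivable φ g C
  unitg   : Derivable φ g (g ∷ [])
  resolve : ∀ {l C D} → Derivable φ g (l ∷ []) → Derivable φ g C → neg l ∈ C →
            (∀ m → (m ∈ D → (m ∈ C × m ≢ neg l)) × ((m ∈ C × m ≢ neg l) → m ∈ D)) →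
            Derivable φ g D

_∧_⊢₁_ : ∀ {n k} → CNF n k → Lit n k → Lit n k → Set
φ ∧ g ⊢₁ h = Derivable φ g (h ∷ [])

LitTrue : ∀ {n k} → (Var n k → Bool) → Lit n k → Set
LitTrue a (v , b) = a v ≡ b

Satisfies : ∀ {n k} → (Var n k → Bool) → CNF n k → Set
Satisfies a φ = All (Any (LitTrue a)) φ

SatWith : ∀ {n k} → CNF n k → Lit n k → Set
SatWith {n} {k} φ g = Σ (Var n k → Bool) λ a → Satisfies a φ × LitTrue a g

PEncoding : ∀ {n k} → CNF n k → Set
PEncoding {n} φ =
  (∀ (i : Fin n) → SatWith φ (inp i)) ×
  (∀ (i j : Fin n) → i ≢ j → φ ∧ inp i ⊢₁ neg (inp j))

Q : ∀ {n k} → CNF n k → Fin n → CNF n k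
Q φ i = filter (λ C → DecMem._∈?_ _≟L_ (neg (inp i)) C) φ

RegularForm : ∀ {n k} → CNF n k → Set
RegularForm {n} φ = ∀ (i : Fin n) →
  (length (Q φ i) ≡ 2) ×                                               -- R1
  All (λ C → (∀ l → l ∈ C → ∀ (j : Fin n) → proj₁ l ≡ inj₁ j → j ≡ i)   -- R2
             × (length C ≡ 2)) (Q φ i)                                 -- R3

-- By R1–R3 each Q_j consists of two clauses ¬x_j ∨ a with a auxiliary, and the
-- Q_j are disjoint; write |φ| = m + 2n.  By P2 unit propagation from x_i refutes
-- x_j through a clause ¬x_j ∨ a of Q_j, after deriving ¬a from a reason clause
-- (a "blocker" with its "cause").  By P1 (soundness of unit resolution) the cause
-- contains no ¬x_j′ with j′ ≠ i, and a clause is the cause of only one literal.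
-- Fix the input x₀.  The causes of x₀ refuting the other n − 1 inputs avoid their
-- Q_j, so there are at most m + 2 of them.  If s ≥ 3 inputs share a cause, they
-- share the literal ℓ of a clause ¬x_j ∨ ℓ, and blocking among them yields s − 1
-- distinct clauses outside every Q_j (fibre bound), so s − 1 ≤ m.  Pigeonhole gives
-- n − 1 ≤ (m + 2) · max(2, m + 1), which for n ≥ 7 is the claimed inequality.
module Submission where

open import Defs
open import Data.Nat using (ℕ; zero; suc; _≤_; _<_; _+_; _*_; _∸_; _^_; _⊔_; z≤n; s≤s; s≤s⁻¹; _<?_)
open import Data.Nat.Properties
open import Data.Nat.Tactic.RingSolver using (solve-∀)
open import Data.Bool using (Bool; true; false; not)
import Data.Bool.Properties as BoolP
open import Data.Fin using (Fin; zero; suc)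
import Data.Fin.Properties as FinP
open import Data.Product using (_×_; _,_; proj₁; proj₂; Σ-syntax)
open import Data.Sum as Sum using (_⊎_; inj₁; inj₂; [_,_]′)
open import Data.Unit using (⊤; tt)
open import Data.Empty using (⊥; ⊥-elim)
open import Function using (_∘_; id)
open import Data.List using (List; []; _∷_; length; filter; map; _++_; allFin)
open import Data.List.Properties using (length-++; length-map; length-tabulate; ≡-dec)
open import Data.List.Relation.Unary.All as All using (All; []; _∷_)
open import Data.List.Relation.Unary.Any using (Any; here; there)
open import Data.List.Relation.Unary.AllPairs as AllPairs using ([]; _∷_)
open import Data.List.Relation.Unary.Unique.Propositional using (Unique)
import Data.List.Relation.Unary.Unique.Propositional.Properties as Unique
open import Data.List.Relation.Binary.Subset.Propositional using (_⊆_)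
open import Data.List.Membership.Propositional using (_∈_; _∉_; find; lose)
open import Data.List.Membership.Propositional.Properties using (∈-∃++; ∈-++⁻; ∈-++⁺ˡ; ∈-++⁺ʳ; ∈-filter⁻; ∈-filter⁺; ∈-map⁻)
import Data.List.Membership.DecPropositional as DecMembership
open import Relation.Nullary using (¬_; yes; no)
open import Relation.Nullary.Decidable using (¬?)
open import Level using (0ℓ)
open import Relation.Unary using (Pred; Decidable)
open import Relation.Binary.Definitions using (DecidableEquality)
open import Relation.Binary.PropositionalEquality using (_≡_; _≢_; refl; sym; trans; cong; cong₂; subst; module ≡-Reasoning)

unique-⊆-length : ∀ {A : Set} {xs ys : List A} → Unique xs → xs ⊆ ys → length xs ≤ length ys
unique-⊆-length {xs = []} _ _ = z≤n
unique-⊆-length {xs = x ∷ xs} (x∉xs ∷ u) xs⊆ys with ∈-∃++ (xs⊆ys (here refl))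
... | us , vs , refl = begin
  suc (length xs)            ≤⟨ s≤s (unique-⊆-length u xs⊆us++vs) ⟩
  suc (length (us ++ vs))    ≡⟨ cong suc (length-++ us) ⟩
  suc (length us + length vs) ≡⟨ sym (+-suc (length us) (length vs)) ⟩
  length us + length (x ∷ vs) ≡⟨ sym (length-++ us) ⟩
  length (us ++ x ∷ vs)      ∎
  where
  open ≤-Reasoning
  -- removing the copy of x loses nothing, since x does not occur in xs
  xs⊆us++vs : xs ⊆ us ++ vs
  xs⊆us++vs y∈xs with ∈-++⁻ us (xs⊆ys (there y∈xs))
  ... | inj₁ y∈us = ∈-++⁺ˡ y∈us
  ... | inj₂ (here y≡x) = ⊥-elim (All.lookup x∉xs y∈xs (sym y≡x))
  ... | inj₂ (there y∈vs) = ∈-++⁺ʳ us y∈vs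

length-allFin : ∀ n → length (allFin n) ≡ n
length-allFin n = length-tabulate {n = n} id

length-filter-split : ∀ {A : Set} {P : Pred A 0ℓ} (P? : Decidable P) (xs : List A) →
                      length (filter P? xs) + length (filter (¬? ∘ P?) xs) ≡ length xs
length-filter-split P? [] = refl
length-filter-split P? (x ∷ xs) with P? x
... | yes _ = cong suc (length-filter-split P? xs)
... | no _  = trans (+-suc _ _) (cong suc (length-filter-split P? xs))

unique-map-on : ∀ {A B : Set} (f : A → B) {xs : List A} → Unique xs →
                (∀ {x y} → x ∈ xs → y ∈ xs → f x ≡ f y → x ≡ y) → Unique (map f xs)
unique-map-on f {[]} _ _ = []
unique-map-on f {x ∷ xs} (x∉xs ∷ u) inj =
  images-differ xs x∉xs (λ z → z) ∷ unique-map-on f u (λ p q → inj (there p) (there q))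
  where
  images-differ : ∀ zs → All (x ≢_) zs → zs ⊆ xs → All (f x ≢_) (map f zs)
  images-differ [] _ _ = []
  images-differ (z ∷ zs) (x≢z ∷ x∉zs) zs⊆xs =
    (λ fx≡fz → x≢z (inj (here refl) (there (zs⊆xs (here refl))) fx≡fz))
    ∷ images-differ zs x∉zs (zs⊆xs ∘ there)

another-member : ∀ {A : Set} (_≟_ : DecidableEquality A) {R : List A} → Unique R → 2 ≤ length R →
                 (k : A) → Σ[ j ∈ A ] j ∈ R × j ≢ k
another-member _≟_ {r₁ ∷ r₂ ∷ _} ((r₁≢r₂ ∷ _) ∷ _) _ k with r₁ ≟ k
... | yes refl = r₂ , there (here refl) , r₁≢r₂ ∘ sym
... | no r₁≢k  = r₁ , here refl , r₁≢k
another-member _≟_ {_ ∷ []} _ (s≤s ()) _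

two-element : ∀ {A : Set} {xs : List A} {x y z : A} → length xs ≡ 2 →
              x ∈ xs → y ∈ xs → z ∈ xs → x ≢ y → x ≢ z → y ≡ z
two-element {xs = p ∷ q ∷ []} refl = pair
  where
  pair : ∀ {x y z} → x ∈ p ∷ q ∷ [] → y ∈ p ∷ q ∷ [] → z ∈ p ∷ q ∷ [] → x ≢ y → x ≢ z → y ≡ z
  pair _ (here refl) (here refl) _ _ = refl
  pair _ (there (here refl)) (there (here refl)) _ _ = refl
  pair (here refl) (here refl) (there (here refl)) x≢y _ = ⊥-elim (x≢y refl)
  pair (here refl) (there (here refl)) (here refl) _ x≢z = ⊥-elim (x≢z refl)
  pair (there (here refl)) (here refl) (there (here refl)) _ x≢z = ⊥-elim (x≢z refl)
  pair (there (here refl)) (there (here refl)) (here refl) x≢y _ = ⊥-elim (x≢y refl)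
  pair (there (there ())) _ _ _ _
  pair _ (there (there ())) _ _ _
  pair _ _ (there (there ())) _ _

module Pigeonhole {A X : Set} (_≟_ : DecidableEquality X) (colour : A → X) where

  record BigFibre (B : ℕ) (xs : List A) : Set where
    constructor fibre
    field
      members  : List A
      value    : X
      distinct : Unique members
      inside   : members ⊆ xs
      large    : B < length members
      constant : ∀ {y} → y ∈ members → colour y ≡ value

  record BigImage (K : ℕ) (xs : List A) : Set where
    constructor image
    field
      values   : List X
      distinct : Unique values
      large    : K < length values
      attained : ∀ {v} → v ∈ values → Σ[ x ∈ A ] x ∈ xs × colour x ≡ v

  same-as? : (x : A) → Decidable (λ y → colour y ≡ colour x)
  same-as? x y = colour y ≟ colour x

  differ-from? : (x : A) → Decidable (λ y → ¬ colour y ≡ colour x)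
  differ-from? x = ¬? ∘ same-as? x

  fibre-mono : ∀ {B xs ys} → xs ⊆ ys → BigFibre B xs → BigFibre B ys
  fibre-mono xs⊆ys (fibre zs v u zs⊆xs large constant) = fibre zs v u (xs⊆ys ∘ zs⊆xs) large constant

  -- x's colour is new among the colours of the elements not coloured like x
  image-extend : ∀ {K} x xs → BigImage K (filter (differ-from? x) (x ∷ xs)) → BigImage (suc K) (x ∷ xs)
  image-extend x xs (image vs uvs large attained) = image (colour x ∷ vs) (new ∷ uvs) (s≤s large) attained′
    where
    new : All (colour x ≢_) vs
    new = All.tabulate λ v∈vs cx≡v →
      let (y , y∈ , cy≡v) = attained v∈vs in proj₂ (∈-filter⁻ (differ-from? x) y∈) (trans cy≡v (sym cx≡v))
    attained′ : ∀ {v} → v ∈ colour x ∷ vs → Σ[ y ∈ A ] y ∈ x ∷ xs × colour y ≡ v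
    attained′ (here refl) = x , here refl , refl
    attained′ (there v∈vs) =
      let (y , y∈ , cy≡v) = attained v∈vs in y , proj₁ (∈-filter⁻ (differ-from? x) y∈) , cy≡v

  -- Induction on K: either x's colour class is large, or the rest has more than K · B elements.
  fibre-or-image : ∀ K B (xs : List A) → Unique xs → K * B < length xs → BigFibre B xs ⊎ BigImage K xs
  fibre-or-image K B [] _ ()
  fibre-or-image zero B (x ∷ xs) _ _ =
    inj₂ (image (colour x ∷ []) ([] ∷ []) (s≤s z≤n) λ { (here refl) → x , here refl , refl })
  fibre-or-image (suc K) B (x ∷ xs) u lt with B <? length (filter (same-as? x) (x ∷ xs))
  ... | yes big = inj₁ (fibre (filter (same-as? x) (x ∷ xs)) (colour x) (Unique.filter⁺ (same-as? x) u)
                          (proj₁ ∘ ∈-filter⁻ (same-as? x)) big (proj₂ ∘ ∈-filter⁻ (same-as? x)))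
  ... | no small = Sum.map (fibre-mono (proj₁ ∘ ∈-filter⁻ (differ-from? x))) (image-extend x xs)
                     (fibre-or-image K B rest (Unique.filter⁺ (differ-from? x) u) rest-large)
    where
    same = filter (same-as? x) (x ∷ xs)
    rest = filter (differ-from? x) (x ∷ xs)
    rest-large : K * B < length rest
    rest-large = +-cancelˡ-< (length same) _ _
      (subst (length same + K * B <_) (sym (length-filter-split (same-as? x) (x ∷ xs)))
        (≤-<-trans (+-monoˡ-≤ (K * B) (≮⇒≥ small)) lt))

neg-involutive : ∀ {n k} (l : Lit n k) → neg (neg l) ≡ l
neg-involutive (v , b) = cong (v ,_) (BoolP.not-involutive b)

neg-injective : ∀ {n k} {l l′ : Lit n k} → neg l ≡ neg l′ → l ≡ l′
neg-injective {l = l} {l′} e = trans (sym (neg-involutive l)) (trans (cong neg e) (neg-involutive l′))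

IsAux : ∀ {n k} → Lit n k → Set
IsAux (inj₁ _ , _) = ⊥
IsAux (inj₂ _ , _) = ⊤

aux-neg : ∀ {n k} {l : Lit n k} → IsAux l → IsAux (neg l)
aux-neg {l = inj₂ _ , _} _ = tt

aux≢input : ∀ {n k} {l : Lit n k} {j : Fin n} {b : Bool} → IsAux l → l ≢ (inj₁ j , b)
aux≢input {l = inj₂ _ , _} _ ()

module UnitResolution {n k : ℕ} (φ : CNF n k) where

  open DecMembership (_≟L_ {n} {k}) using (_∈?_)

  sound : ∀ {g} {α : Var n k → Bool} → Satisfies α φ → LitTrue α g →
          ∀ {C} → Derivable φ g C → Any (LitTrue α) C
  sound sat g-true (axiom C∈φ) = All.lookup sat C∈φ
  sound sat g-true unitg = here g-true
  sound sat g-true (resolve {v , b} dl dC _ D-spec) with sound sat g-true dl | find (sound sat g-true dC)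
  ... | here l-true | m , m∈C , m-true with m ≟L (v , not b)
  ...   | yes refl = ⊥-elim (BoolP.not-¬ l-true m-true)
  ...   | no m≢¬l = lose (proj₂ (D-spec m) (m∈C , m≢¬l)) m-true

  consistent : ∀ {g l} → SatWith φ g → φ ∧ g ⊢₁ l → φ ∧ g ⊢₁ neg l → ⊥
  consistent {l = v , b} (α , sat , g-true) dl d¬l with sound sat g-true dl | sound sat g-true d¬l
  ... | here l-true | here ¬l-true = BoolP.not-¬ l-true ¬l-true

  Resolvent : Lit n k → Clause n k → Clause n k → Set
  Resolvent l C D = ∀ m → (m ∈ D → m ∈ C × m ≢ neg l) × (m ∈ C × m ≢ neg l → m ∈ D)

  resolvent-⊆ : ∀ {l C D} → Resolvent l C D → D ⊆ C
  resolvent-⊆ D-spec {m} m∈D = proj₁ (proj₁ (D-spec m) m∈D)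

  -- The only literal lost in resolving on the unit l is ¬l, which l refutes.
  lost-refuted : ∀ {g l C D} → φ ∧ g ⊢₁ l → Resolvent l C D →
                 ∀ l′ → l′ ∈ C → l′ ∉ D → φ ∧ g ⊢₁ neg l′
  lost-refuted {g} {l} dl D-spec l′ l′∈C l′∉D with l′ ≟L neg l
  ... | yes l′≡¬l = subst (φ ∧ g ⊢₁_) (sym (trans (cong neg l′≡¬l) (neg-involutive l))) dl
  ... | no l′≢¬l = ⊥-elim (l′∉D (proj₂ (D-spec l′) (l′∈C , l′≢¬l)))

  trace : ∀ {g C} → Derivable φ g C → (∀ {l} → l ∈ C → l ≡ g) ⊎
          Σ[ O ∈ Clause n k ] O ∈ φ × C ⊆ O × (∀ l → l ∈ O → l ∉ C → φ ∧ g ⊢₁ neg l)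
  trace (axiom {C} C∈φ) = inj₂ (C , C∈φ , (λ l∈C → l∈C) , λ _ l∈C l∉C → ⊥-elim (l∉C l∈C))
  trace unitg = inj₁ λ { (here l≡g) → l≡g }
  trace {g} {D} (resolve {l} {C} dl dC _ D-spec) with trace dC
  ... | inj₁ C⊆g = inj₁ (C⊆g ∘ resolvent-⊆ D-spec)
  ... | inj₂ (O , O∈φ , C⊆O , refuted) = inj₂ (O , O∈φ , C⊆O ∘ resolvent-⊆ D-spec , refuted′)
    where
    refuted′ : ∀ l′ → l′ ∈ O → l′ ∉ D → φ ∧ g ⊢₁ neg l′
    refuted′ l′ l′∈O l′∉D with l′ ∈? C
    ... | no l′∉C = refuted l′ l′∈O l′∉C
    ... | yes l′∈C = lost-refuted dl D-spec l′ l′∈C l′∉D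

  record Reason (g l : Lit n k) : Set where
    field
      derived        : φ ∧ g ⊢₁ l
      clause         : Clause n k
      clause∈φ       : clause ∈ φ
      l∈clause       : l ∈ clause
      others-refuted : ∀ l′ → l′ ∈ clause → l′ ≢ l → φ ∧ g ⊢₁ neg l′

  reason : ∀ {g l} → φ ∧ g ⊢₁ l → l ≢ g → Reason g l
  reason d l≢g with trace d
  ... | inj₁ ⊆g = ⊥-elim (l≢g (⊆g (here refl)))
  ... | inj₂ (O , O∈φ , l⊆O , refuted) = record
    { derived = d ; clause = O ; clause∈φ = O∈φ ; l∈clause = l⊆O (here refl)
    ; others-refuted = λ l′ l′∈O l′≢l → refuted l′ l′∈O λ { (here l′≡l) → l′≢l l′≡l } }

  reason-determines : ∀ {g l l′} → SatWith φ g → (r : Reason g l) (r′ : Reason g l′) →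
                      Reason.clause r ≡ Reason.clause r′ → l ≡ l′
  reason-determines {l = l} {l′} sat r r′ same with l′ ≟L l
  ... | yes l′≡l = sym l′≡l
  ... | no l′≢l = ⊥-elim (consistent sat (Reason.derived r′)
                   (Reason.others-refuted r l′ (subst (l′ ∈_) (sym same) (Reason.l∈clause r′)) l′≢l))

module RegularEncoding {n k : ℕ} (φ : CNF n k) (wf : WfCNF φ) (pe : PEncoding φ) (rf : RegularForm φ) where

  open UnitResolution φ
  open DecMembership (_≟L_ {n} {k}) using (_∈?_)

  L : Set
  L = Lit n k

  Forces : Fin n → L → Set
  Forces i l = φ ∧ inp i ⊢₁ l

  contradictory : ∀ {i l} → Forces i l → Forces i (neg l) → ⊥
  contradictory {i} = consistent (proj₁ pe i)

  Q-member : ∀ {j C} → C ∈ Q φ j → C ∈ φ × neg (inp j) ∈ C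
  Q-member {j} = ∈-filter⁻ (neg (inp j) ∈?_)

  Q-intro : ∀ {j C} → C ∈ φ → neg (inp j) ∈ C → C ∈ Q φ j
  Q-intro {j} = ∈-filter⁺ (neg (inp j) ∈?_)

  OnlyInput : Fin n → Clause n k → Set
  OnlyInput j C = ∀ l → l ∈ C → ∀ (j′ : Fin n) → proj₁ l ≡ inj₁ j′ → j′ ≡ j

  record QShape (j : Fin n) (a : L) (C : Clause n k) : Set where
    field
      ¬x∈  : neg (inp j) ∈ C
      a∈   : a ∈ C
      only : ∀ {m} → m ∈ C → m ≡ neg (inp j) ⊎ m ≡ a
      aux  : IsAux a

  -- In a well-formed clause satisfying R2, a literal other than ¬x_j is auxiliary:
  -- x_j would be complementary to ¬x_j, and ¬x_j occurs only once.
  partner-aux : ∀ {j C} (a : L) → WfClause C → OnlyInput j C →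
                neg (inp j) ∈ C → a ∈ C → a ≢ neg (inp j) → IsAux a
  partner-aux (inj₂ _ , _) _ _ _ _ _ = tt
  partner-aux (inj₁ j′ , true) (_ , no-complement) only-j ¬x∈ a∈ _ with only-j _ a∈ j′ refl
  ... | refl = no-complement _ a∈ ¬x∈
  partner-aux (inj₁ j′ , false) _ only-j _ a∈ a≢¬x with only-j _ a∈ j′ refl
  ... | refl = a≢¬x refl

  q-shape : ∀ {j C} → C ∈ Q φ j → Σ[ a ∈ L ] QShape j a C
  q-shape {j} {C} C∈Q = binary C (All.lookup (proj₁ wf) C∈φ) only-j length≡2 ¬x∈
    where
    C∈φ = proj₁ (Q-member C∈Q)
    ¬x∈ = proj₂ (Q-member C∈Q)
    only-j = proj₁ (All.lookup (proj₂ (rf j)) C∈Q)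
    length≡2 = proj₂ (All.lookup (proj₂ (rf j)) C∈Q)
    binary : ∀ C → WfClause C → OnlyInput j C → length C ≡ 2 → neg (inp j) ∈ C → Σ[ a ∈ L ] QShape j a C
    binary (u ∷ w ∷ []) wfC@((u≢w ∷ []) ∷ _ , _) r2 refl (here refl) = w , record
      { ¬x∈ = here refl ; a∈ = there (here refl)
      ; only = λ { (here e) → inj₁ e ; (there (here e)) → inj₂ e ; (there (there ())) }
      ; aux = partner-aux w wfC r2 (here refl) (there (here refl)) (u≢w ∘ sym) }
    binary (u ∷ w ∷ []) wfC@((u≢w ∷ []) ∷ _ , _) r2 refl (there (here refl)) = u , record
      { ¬x∈ = there (here refl) ; a∈ = here refl
      ; only = λ { (here e) → inj₂ e ; (there (here e)) → inj₁ e ; (there (there ())) }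
      ; aux = partner-aux u wfC r2 (there (here refl)) (here refl) u≢w }
    binary (u ∷ w ∷ []) _ _ refl (there (there ()))

  shape-aux : ∀ {j a t C} → QShape j a C → t ∈ C → IsAux t → t ≡ a
  shape-aux s t∈C aux-t with QShape.only s t∈C
  ... | inj₁ t≡¬x = ⊥-elim (aux≢input aux-t t≡¬x)
  ... | inj₂ t≡a = t≡a

  shape-unique : ∀ {j a b C} → QShape j a C → QShape j b C → a ≡ b
  shape-unique s s′ = sym (shape-aux s (QShape.a∈ s′) (QShape.aux s′))

  forces-partner : ∀ {i a C} → C ∈ Q φ i → QShape i a C → Forces i a
  forces-partner {i} {a} {C} C∈Q s = resolve unitg (axiom (proj₁ (Q-member C∈Q))) (QShape.¬x∈ s) resolvent
    where
    resolvent : Resolvent (inp i) C (a ∷ [])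
    resolvent m = (λ { (here refl) → QShape.a∈ s , aux≢input (QShape.aux s) })
                , λ (m∈C , m≢¬x) → [ (λ m≡¬x → ⊥-elim (m≢¬x m≡¬x)) , here ]′ (QShape.only s m∈C)

  -- Q_j has just two clauses (R1): if C₂ and C₃ avoid the auxiliary literal ℓ of C₁,
  -- they are the same clause and have the same auxiliary literal.
  Q-pair : ∀ {j ℓ a b C₁ C₂ C₃} → C₁ ∈ Q φ j → QShape j ℓ C₁ → C₂ ∈ Q φ j → QShape j a C₂ →
           C₃ ∈ Q φ j → QShape j b C₃ → a ≢ ℓ → b ≢ ℓ → a ≡ b
  Q-pair {j} {b = b} C₁∈ s₁ C₂∈ s₂ C₃∈ s₃ a≢ℓ b≢ℓ =
    shape-unique s₂ (subst (QShape j b) (sym C₂≡C₃) s₃)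
    where
    C₂≡C₃ = two-element (proj₁ (rf j)) C₁∈ C₂∈ C₃∈
              (λ { refl → a≢ℓ (shape-unique s₂ s₁) }) (λ { refl → b≢ℓ (shape-unique s₃ s₁) })

  -- How unit propagation from x_i refutes x_j: it derives ¬a, for a clause ¬x_j ∨ a
  -- of Q_j, from a reason clause (the cause).
  record Blocker (i j : Fin n) : Set where
    field
      lit      : L
      clause   : Clause n k
      clause∈Q : clause ∈ Q φ j
      shape    : QShape j lit clause
      cause    : Reason (inp i) (neg lit)

    cause-clause : Clause n k
    cause-clause = Reason.clause cause

    cause-clause∈φ : cause-clause ∈ φ
    cause-clause∈φ = Reason.clause∈φ cause

  open Blocker

  -- By P2 every x_i refutes every other x_j, and the refutation passes through Q_j.
  blocker : ∀ {i j} → i ≢ j → Blocker i j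
  blocker {i} {j} i≢j = record
    { lit = a ; clause = R.clause ; clause∈Q = O∈Q ; shape = s
    ; cause = reason (R.others-refuted a (QShape.a∈ s) (aux≢input (QShape.aux s)))
                     (aux≢input (aux-neg (QShape.aux s))) }
    where
    module R = Reason (reason (proj₂ pe i j i≢j) (λ ()))
    O∈Q = Q-intro R.clause∈φ R.l∈clause
    a = proj₁ (q-shape O∈Q)
    s = proj₂ (q-shape O∈Q)

  -- The cause of refuting x_j from x_i contains no ¬x_j′ with j′ ≠ i, since x_i refutes x_j′.
  cause-avoids-inputs : ∀ {i j j′} (b : Blocker i j) → i ≢ j′ → neg (inp j′) ∉ cause-clause b
  cause-avoids-inputs {i} {j′ = j′} b i≢j′ ¬x∈ = contradictory (proj₂ pe i j′ i≢j′)
    (Reason.others-refuted (cause b) (neg (inp j′)) ¬x∈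
      (λ e → aux≢input (aux-neg (QShape.aux (shape b))) (sym e)))

  blockers-determined : ∀ {i j j′} (b : Blocker i j) (b′ : Blocker i j′) →
                        cause-clause b ≡ cause-clause b′ → lit b ≡ lit b′
  blockers-determined {i} b b′ same = neg-injective (reason-determines (proj₁ pe i) (cause b) (cause b′) same)

  cause-partner : ∀ {i j j′ c} (b : Blocker i j) → QShape j′ c (cause-clause b) → lit b ≡ neg c
  cause-partner b sc = trans (sym (neg-involutive (lit b)))
    (cong neg (shape-aux sc (Reason.l∈clause (cause b)) (aux-neg (QShape.aux (shape b)))))

  φ-unique : Unique φ
  φ-unique = AllPairs.map (λ {C} distinct C≡D → distinct (subst (SameSet C) C≡D λ _ → (λ p → p) , (λ p → p))) (proj₂ wf)

  -- By R2 the sets Q_j are pairwise disjoint.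
  Q-disjoint : ∀ {j j′ C} → C ∈ Q φ j → C ∈ Q φ j′ → j′ ≡ j
  Q-disjoint {j} {j′} C∈Qj C∈Qj′ = proj₁ (All.lookup (proj₂ (rf j)) C∈Qj) (neg (inp j′)) (proj₂ (Q-member C∈Qj′)) j′ refl

  Qs : List (Fin n) → CNF n k
  Qs [] = []
  Qs (j ∷ js) = Q φ j ++ Qs js

  Qs-length : ∀ js → length (Qs js) ≡ 2 * length js
  Qs-length [] = refl
  Qs-length (j ∷ js) = begin
    length (Q φ j ++ Qs js)          ≡⟨ length-++ (Q φ j) ⟩
    length (Q φ j) + length (Qs js) ≡⟨ cong₂ _+_ (proj₁ (rf j)) (Qs-length js) ⟩
    2 + 2 * length js               ≡⟨ sym (*-suc 2 (length js)) ⟩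
    2 * length (j ∷ js)             ∎
    where open ≡-Reasoning

  Qs-member : ∀ js {C} → C ∈ Qs js → Σ[ j ∈ Fin n ] j ∈ js × C ∈ Q φ j
  Qs-member (j ∷ js) C∈ with ∈-++⁻ (Q φ j) C∈
  ... | inj₁ C∈Qj = j , here refl , C∈Qj
  ... | inj₂ C∈Qs = let (j′ , j′∈js , C∈Qj′) = Qs-member js C∈Qs in j′ , there j′∈js , C∈Qj′

  Qs-unique : ∀ {js} → Unique js → Unique (Qs js)
  Qs-unique {[]} _ = []
  Qs-unique {j ∷ js} (j∉js ∷ u) = Unique.++⁺ (Unique.filter⁺ _ φ-unique) (Qs-unique u) λ (C∈Qj , C∈Qs) →
    let (j′ , j′∈js , C∈Qj′) = Qs-member js C∈Qs in All.lookup j∉js j′∈js (sym (Q-disjoint C∈Qj C∈Qj′))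

  outside-Q-bound : ∀ (js : List (Fin n)) (vs : CNF n k) → Unique js → Unique vs → vs ⊆ φ →
                    (∀ {v j} → v ∈ vs → j ∈ js → neg (inp j) ∉ v) → length vs + 2 * length js ≤ length φ
  outside-Q-bound js vs ujs uvs vs⊆φ outside =
    subst (_≤ length φ) (trans (length-++ vs) (cong (length vs +_) (Qs-length js)))
      (unique-⊆-length (Unique.++⁺ uvs (Qs-unique ujs) disjoint) all⊆φ)
    where
    disjoint : ∀ {v} → ¬ (v ∈ vs × v ∈ Qs js)
    disjoint (v∈vs , v∈Qs) = let (j , j∈js , v∈Qj) = Qs-member js v∈Qs in
      outside v∈vs j∈js (proj₂ (Q-member v∈Qj))
    all⊆φ : vs ++ Qs js ⊆ φ
    all⊆φ v∈ with ∈-++⁻ vs v∈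
    ... | inj₁ v∈vs = vs⊆φ v∈vs
    ... | inj₂ v∈Qs = let (_ , _ , v∈Qj) = Qs-member js v∈Qs in proj₁ (Q-member v∈Qj)

  outside-all-Q-bound : ∀ (vs : CNF n k) → Unique vs → vs ⊆ φ →
                        (∀ {v} j → v ∈ vs → neg (inp j) ∉ v) → length vs + 2 * n ≤ length φ
  outside-all-Q-bound vs uvs vs⊆φ outside =
    subst (λ z → length vs + 2 * z ≤ length φ) (length-allFin n)
      (outside-Q-bound (allFin n) vs (Unique.allFin⁺ n) uvs vs⊆φ (λ v∈ _ → outside _ v∈))

  two-per-input : 2 * n ≤ length φ
  two-per-input = outside-all-Q-bound [] [] (λ ()) (λ _ ())

  Spoke : Fin n → L → Set
  Spoke j ℓ = Σ[ C ∈ Clause n k ] C ∈ Q φ j × QShape j ℓ C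

  -- Let the distinct inputs j₁ ∷ R all have a clause ¬x_j ∨ ℓ in Q_j,
  -- for one literal ℓ.  Then x_j₁ refutes each x_j (j ∈ R) through the other clause
  -- of Q_j, and if |R| ≥ 2 the causes are |R| distinct clauses outside every Q_j.
  module Fibre (ℓ : L) (j₁ : Fin n) (R : List (Fin n)) (distinct : Unique (j₁ ∷ R))
               (spoke : ∀ {j} → j ∈ j₁ ∷ R → Spoke j ℓ) where

    forces-ℓ : ∀ {j} → j ∈ j₁ ∷ R → Forces j ℓ
    forces-ℓ j∈ = let (_ , C∈Q , s) = spoke j∈ in forces-partner C∈Q s

    blocker-avoids-ℓ : ∀ {i j} → i ∈ j₁ ∷ R → (b : Blocker i j) → lit b ≢ ℓ
    blocker-avoids-ℓ i∈ b refl = contradictory (forces-ℓ i∈) (Reason.derived (cause b))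

    other-literal : ∀ {j a b C C′} → j ∈ j₁ ∷ R → C ∈ Q φ j → QShape j a C → a ≢ ℓ →
                    C′ ∈ Q φ j → QShape j b C′ → b ≢ ℓ → a ≡ b
    other-literal j∈ C∈Q s a≢ℓ C′∈Q s′ b≢ℓ =
      let (_ , ℓ∈Q , sℓ) = spoke j∈ in Q-pair ℓ∈Q sℓ C∈Q s C′∈Q s′ a≢ℓ b≢ℓ

    blockers-agree : ∀ {i i′ j} → i ∈ j₁ ∷ R → i′ ∈ j₁ ∷ R → j ∈ j₁ ∷ R →
                     (b : Blocker i j) (b′ : Blocker i′ j) → lit b ≡ lit b′
    blockers-agree i∈ i′∈ j∈ b b′ = other-literal j∈ (clause∈Q b) (shape b) (blocker-avoids-ℓ i∈ b)
                                                   (clause∈Q b′) (shape b′) (blocker-avoids-ℓ i′∈ b′)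

    j₁∉R : ∀ {j} → j ∈ R → j₁ ≢ j
    j₁∉R = All.lookup (AllPairs.head distinct)

    -- the cause of refuting x_j from x_j₁ (the empty clause for j = j₁, never used)
    cause-of : Fin n → Clause n k
    cause-of j with j₁ FinP.≟ j
    ... | yes _ = []
    ... | no j₁≢j = cause-clause (blocker j₁≢j)

    cause-of-blocker : ∀ {j} → j ∈ R → Σ[ b ∈ Blocker j₁ j ] cause-of j ≡ cause-clause b
    cause-of-blocker {j} j∈R with j₁ FinP.≟ j
    ... | yes j₁≡j = ⊥-elim (j₁∉R j∈R j₁≡j)
    ... | no j₁≢j = blocker j₁≢j , refl

    -- equal causes would make x_j both derive and refute its own literal
    cause-of-injective : ∀ {j j′} → j ∈ R → j′ ∈ R → cause-of j ≡ cause-of j′ → j ≡ j′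
    cause-of-injective {j} {j′} j∈R j′∈R same with j FinP.≟ j′
    ... | yes j≡j′ = j≡j′
    ... | no j≢j′ = ⊥-elim (contradictory (forces-partner (clause∈Q b) (shape b)) refutes)
      where
      b = proj₁ (cause-of-blocker j∈R)
      b′ = proj₁ (cause-of-blocker j′∈R)
      c = blocker j≢j′
      same-lit : lit b ≡ lit c
      same-lit = trans (blockers-determined b b′ (trans (sym (proj₂ (cause-of-blocker j∈R)))
                                                 (trans same (proj₂ (cause-of-blocker j′∈R)))))
                       (blockers-agree (here refl) (there j∈R) (there j′∈R) b′ c)
      refutes : Forces j (neg (lit b))
      refutes = subst (Forces j ∘ neg) (sym same-lit) (Reason.derived (cause c))

    -- a cause lying in Q_j₁ would be ¬x_j₁ ∨ ¬a for the blocked literal a; then either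
    -- a = ¬ℓ, or a third input x_j₃ of the fibre derives both a and ¬a
    cause-not-in-Q-j₁ : 2 ≤ length R → ∀ {j} → j ∈ R → (b : Blocker j₁ j) → cause-clause b ∉ Q φ j₁
    cause-not-in-Q-j₁ two {j} j∈R b O∈Q with q-shape O∈Q
    ... | c , sc with c ≟L ℓ
    ...   | yes c≡ℓ = contradictory (forces-ℓ (there j∈R))
                        (subst (Forces j) (trans (cause-partner b sc) (cong neg c≡ℓ))
                          (forces-partner (clause∈Q b) (shape b)))
    ...   | no c≢ℓ = contradictory (subst (Forces j₃) a≡¬d (Reason.derived (cause d)))
                                   (subst (Forces j₃ ∘ neg) e≡a (Reason.derived (cause e)))
      where
      third = another-member FinP._≟_ (AllPairs.tail distinct) two j
      j₃ = proj₁ third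
      j₃∈R = proj₁ (proj₂ third)
      d = blocker (λ j₃≡j₁ → j₁∉R j₃∈R (sym j₃≡j₁))
      e = blocker (proj₂ (proj₂ third))
      a≡¬d : neg (lit d) ≡ lit b
      a≡¬d = trans (cong neg (sym (other-literal (here refl) O∈Q sc c≢ℓ (clause∈Q d) (shape d)
                                                 (blocker-avoids-ℓ (there j₃∈R) d))))
                   (sym (cause-partner b sc))
      e≡a : lit e ≡ lit b
      e≡a = blockers-agree (there j₃∈R) (here refl) (there j∈R) e b

    cause-of-outside : 2 ≤ length R → ∀ {v} j′ → v ∈ map cause-of R → neg (inp j′) ∉ v
    cause-of-outside two j′ v∈ ¬x∈v with ∈-map⁻ cause-of v∈
    ... | j , j∈R , refl with cause-of-blocker j∈R | j₁ FinP.≟ j′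
    ...   | b , eq | no j₁≢j′ = cause-avoids-inputs b j₁≢j′ (subst (neg (inp j′) ∈_) eq ¬x∈v)
    ...   | b , eq | yes refl = cause-not-in-Q-j₁ two j∈R b
                                  (Q-intro (cause-clause∈φ b) (subst (neg (inp j₁) ∈_) eq ¬x∈v))

    causes⊆φ : map cause-of R ⊆ φ
    causes⊆φ v∈ with ∈-map⁻ cause-of v∈
    ... | j , j∈R , refl = let (b , eq) = cause-of-blocker j∈R in
                           subst (_∈ φ) (sym eq) (cause-clause∈φ b)

    fibre-bound : 2 ≤ length R → length R + 2 * n ≤ length φ
    fibre-bound two = subst (λ z → z + 2 * n ≤ length φ) (length-map cause-of R)
      (outside-all-Q-bound (map cause-of R)
        (unique-map-on cause-of (AllPairs.tail distinct) cause-of-injective) causes⊆φ (cause-of-outside two))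

-- The pigeonhole argument around the first input x₀ of n = 1 + n′ inputs, for |φ| = m + 2n:
-- the causes of x₀ refuting x_1, …, x_n′ take at most m + 2 values (they avoid these Q_j),
-- and at most max(2, m + 1) of these inputs share a cause (fibre bound).
module PivotBound {n′ k : ℕ} (φ : CNF (suc n′) k) (wf : WfCNF φ) (pe : PEncoding φ) (rf : RegularForm φ)
                  (m : ℕ) (size≡ : length φ ≡ m + 2 * suc n′) where

  open RegularEncoding φ wf pe rf
  open Blocker

  block : (j : Fin n′) → Blocker zero (suc j)
  block j = blocker (λ ())

  code : Fin n′ → Clause (suc n′) k
  code j = cause-clause (block j)

  open Pigeonhole (≡-dec _≟L_) code

  others : List (Fin (suc n′))
  others = map suc (allFin n′)

  others-outside : ∀ {j′} j → j′ ∈ others → neg (inp j′) ∉ code j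
  others-outside j j′∈ = let (_ , _ , j′≡) = ∈-map⁻ suc j′∈ in
    subst (λ z → neg (inp z) ∉ code j) (sym j′≡) (cause-avoids-inputs (block j) λ ())

  others-length : length others ≡ n′
  others-length = trans (length-map suc (allFin n′)) (length-allFin n′)

  no-big-image : ¬ BigImage (m + 2) (allFin n′)
  no-big-image (image vs uvs large attained) = <⇒≱ large (+-cancelʳ-≤ (2 * n′) (length vs) (m + 2) counted)
    where
    vs⊆φ : vs ⊆ φ
    vs⊆φ v∈ = let (j , _ , code≡v) = attained v∈ in subst (_∈ φ) code≡v (cause-clause∈φ (block j))
    outside : ∀ {v j} → v ∈ vs → j ∈ others → neg (inp j) ∉ v
    outside v∈ j∈ = let (j , _ , code≡v) = attained v∈ in subst (neg (inp _) ∉_) code≡v (others-outside j j∈)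
    counted : length vs + 2 * n′ ≤ (m + 2) + 2 * n′
    counted = begin
      length vs + 2 * n′              ≡⟨ cong (λ z → length vs + 2 * z) (sym others-length) ⟩
      length vs + 2 * length others   ≤⟨ outside-Q-bound others vs (Unique.map⁺ FinP.suc-injective (Unique.allFin⁺ n′))
                                                         uvs vs⊆φ outside ⟩
      length φ                        ≡⟨ size≡ ⟩
      m + 2 * suc n′                  ≡⟨ cong (m +_) (*-suc 2 n′) ⟩
      m + (2 + 2 * n′)                ≡⟨ sym (+-assoc m 2 (2 * n′)) ⟩
      (m + 2) + 2 * n′                ∎
      where open ≤-Reasoning

  no-big-fibre : ¬ BigFibre (2 ⊔ suc m) (allFin n′)
  no-big-fibre (fibre [] _ _ _ () _)
  no-big-fibre (fibre (y ∷ ys) _ uys _ large constant) = <⇒≱ m<|R| |R|≤m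
    where
    R = map suc ys
    B≤|R| : 2 ⊔ suc m ≤ length R
    B≤|R| = subst (2 ⊔ suc m ≤_) (sym (length-map suc ys)) (s≤s⁻¹ large)
    two : 2 ≤ length R
    two = ≤-trans (m≤m⊔n 2 (suc m)) B≤|R|
    m<|R| : m < length R
    m<|R| = ≤-trans (m≤n⊔m 2 (suc m)) B≤|R|
    spoke-at : ∀ {x} → x ∈ y ∷ ys → Spoke (suc x) (lit (block y))
    spoke-at {x} x∈ = clause (block x) , clause∈Q (block x) ,
      subst (λ a → QShape (suc x) a (clause (block x)))
            (blockers-determined (block x) (block y) (trans (constant x∈) (sym (constant (here refl)))))
            (shape (block x))
    spoke : ∀ {j} → j ∈ map suc (y ∷ ys) → Spoke j (lit (block y))
    spoke j∈ = let (x , x∈ , j≡) = ∈-map⁻ suc j∈ in subst (λ j → Spoke j (lit (block y))) (sym j≡) (spoke-at x∈)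
    |R|≤m : length R ≤ m
    |R|≤m = +-cancelʳ-≤ (2 * suc n′) _ m (subst (_ ≤_) size≡
              (Fibre.fibre-bound (lit (block y)) (suc y) R (Unique.map⁺ FinP.suc-injective uys) spoke two))

  pivot-bound : n′ ≤ (m + 2) * (2 ⊔ suc m)
  pivot-bound = ≮⇒≥ λ too-many →
    [ no-big-fibre , no-big-image ]′ (fibre-or-image (m + 2) (2 ⊔ suc m) (allFin n′) (Unique.allFin⁺ n′)
                                        (subst (_ <_) (sym (length-allFin n′)) too-many))

-- The arithmetic: if n − 1 ≤ (m + 2) · max(2, m + 1) and n ≥ 7 then m ≥ 1 and
-- 4n − 3 ≤ (2m + 3)², i.e. m ≥ √(n − 3/4) − 3/2.
excess-bound : ∀ m n′ → 7 ≤ suc n′ → n′ ≤ (m + 2) * (2 ⊔ suc m) → 4 * suc n′ ∸ 3 ≤ (2 * m + 3) ^ 2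
-- (for m = 0 the hypothesis says n − 1 ≤ 4, contradicting n ≥ 7)
excess-bound zero n′ 7≤n n′≤4 = ⊥-elim (<⇒≱ (s≤s⁻¹ 7≤n) (≤-trans n′≤4 (n≤1+n 4)))
excess-bound (suc x) n′ _ bound = m≤n+o⇒m∸n≤o (4 * suc n′) 3 (begin
  4 * suc n′                            ≡⟨ *-suc 4 n′ ⟩
  4 + 4 * n′                            ≤⟨ +-monoʳ-≤ 4 (*-monoʳ-≤ 4 bound) ⟩
  4 + 4 * ((suc x + 2) * suc (suc x))   ≡⟨ square x ⟩
  3 + (2 * suc x + 3) * (2 * suc x + 3) ≡⟨ cong (3 +_) (cong ((2 * suc x + 3) *_) (sym (*-identityʳ _))) ⟩
  3 + (2 * suc x + 3) ^ 2               ∎)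
  where
  open ≤-Reasoning
  square : ∀ y → 4 + 4 * ((suc y + 2) * suc (suc y)) ≡ 3 + (2 * suc y + 3) * (2 * suc y + 3)
  square = solve-∀

size-inequality : ∀ m n′ → 7 ≤ suc n′ → n′ ≤ (m + 2) * (2 ⊔ suc m) →
                  (4 * suc n′ ≤ 2 * (m + 2 * suc n′) + 3) ×
                  (4 * suc n′ ∸ 3 ≤ (2 * (m + 2 * suc n′) + 3 ∸ 4 * suc n′) ^ 2)
size-inequality m n′ 7≤n bound =
    subst (4 * suc n′ ≤_) (sym (doubled m (suc n′))) (m≤n+m (4 * suc n′) (2 * m + 3))
  , subst (λ z → 4 * suc n′ ∸ 3 ≤ z ^ 2) (sym excess) (excess-bound m n′ 7≤n bound)
  where
  doubled : ∀ m n → 2 * (m + 2 * n) + 3 ≡ (2 * m + 3) + 4 * n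
  doubled = solve-∀
  excess : 2 * (m + 2 * suc n′) + 3 ∸ 4 * suc n′ ≡ 2 * m + 3
  excess = trans (cong (_∸ 4 * suc n′) (doubled m (suc n′))) (m+n∸n≡m (2 * m + 3) (4 * suc n′))

lemma16 : ∀ (n k : ℕ) (φ : CNF n k) → 7 ≤ n → WfCNF φ → PEncoding φ → RegularForm φ →
    (4 * n ≤ 2 * size φ + 3) × (4 * n ∸ 3 ≤ (2 * size φ + 3 ∸ 4 * n) ^ 2)
lemma16 zero k φ () wf pe rf
lemma16 (suc n′) k φ 7≤n wf pe rf =
  subst (λ N → (4 * suc n′ ≤ 2 * N + 3) × (4 * suc n′ ∸ 3 ≤ (2 * N + 3 ∸ 4 * suc n′) ^ 2)) (sym size≡)
    (size-inequality m n′ 7≤n (PivotBound.pivot-bound φ wf pe rf m size≡))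
  where
  -- m is the number of clauses beyond the 2n clauses of the sets Q_j
  m = length φ ∸ 2 * suc n′
  size≡ : length φ ≡ m + 2 * suc n′
  size≡ = sym (m∸n+n≡m (RegularEncoding.two-per-input φ wf pe rf))
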